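{- Let $n\ge1$ and $1\le r<\rho(n)$, where $\rho(n)=\max\{k:k(k+1)/2\le n\}$. Then there exists an edge of $G_n$ joining a partition $\lambda\vdash n$ with $\sigma(\lambda)=r$ to a partition $\mu\vdash n$ with $\sigma(\mu)=r+1$.
   Context: $G_n$ is the partition graph: its vertices are the partitions of $n$, and two distinct partitions $\lambda\neq\mu$ are adjacent when $\mu$ is obtained from $\lambda$ by moving one cell from one part (of size $x$, the part shrinking to $x-1$ and disappearing if $x=1$) to another part or to a new part of size $1$, followed by reordering the parts in weakly decreasing order. $\sigma(\lambda)$ is the number of distinct part sizes of $\lambda$. -}

module Defs where

open import Data.Nat using (ℕ; zero; suc; _+_; _*_; _≤_; _<_; _≥_)
open import Data.Nat.Properties using (_≟_)
open import Data.List using (List; []; _∷_; _++_; length; deduplicate)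
open import Data.Nat.ListAction using (sum)
open import Data.List.Relation.Unary.All using (All)
open import Data.List.Relation.Unary.Linked using (Linked)
open import Data.List.Relation.Binary.Permutation.Propositional using (_↭_)
open import Data.Product using (_×_; ∃; ∃₂)
open import Data.Sum using (_⊎_)
open import Relation.Nullary using (¬_)
open import Relation.Binary.PropositionalEquality using (_≡_)

IsPartition : ℕ → List ℕ → Set
IsPartition n λ′ = Linked _≥_ λ′ × All (λ x → 1 ≤ x) λ′ × sum λ′ ≡ n

-- The result of removing one cell from a part of size x:
-- the part becomes x-1, and disappears if x = 1.
shrink : ℕ → List ℕ
shrink zero = []
shrink (suc zero) = []
shrink (suc (suc k)) = suc k ∷ []

-- One-cell move (as multisets): pick a part x ≥ 1 of λ, shrink it, and add
-- the cell either to another part y (becoming y+1) or to a new part of size 1.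
-- Reordering is expressed by "μ is a permutation of the resulting list".
Move : List ℕ → List ℕ → Set
Move λ′ μ =
  (∃₂ λ x rest → λ′ ↭ (suc x ∷ rest) × μ ↭ (1 ∷ shrink (suc x) ++ rest))
  ⊎
  (∃₂ λ x y → ∃ λ rest →
     λ′ ↭ (suc x ∷ y ∷ rest) × μ ↭ (suc y ∷ shrink (suc x) ++ rest))

Adjacent : List ℕ → List ℕ → Set
Adjacent λ′ μ = ¬ (λ′ ≡ μ) × Move λ′ μ

σ : List ℕ → ℕ
σ λ′ = length (deduplicate _≟_ λ′)

IsRho : ℕ → ℕ → Set
IsRho n k = k * suc k ≤ 2 * n × ¬ (suc k * suc (suc k) ≤ 2 * n)

{-# OPTIONS --safe #-}
module Submission where

-- Put r = p + 1. The partitions λ = (h+1, p+1, p, …, 2) and μ = (h, p+1, p, …, 2, 1)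
-- with h > p + 1 have distinct parts, so σ λ = r and σ μ = r + 1, and μ arises from
-- λ by moving one cell of the largest part into a new part of size 1. The smallest
-- possible size, at h = p + 2, is 1 + 2 + ⋯ + (r+1) = (r+1)(r+2)/2, which is at
-- most n exactly because r + 1 ≤ ρ(n); the rest of n goes into the largest part.

open import Defs
open import Data.Nat using (ℕ; zero; suc; _+_; _*_; _≤_; _<_; _>_; z≤n; s≤s)
open import Data.Nat.Properties
  using (_≟_; ≤-refl; ≤-trans; <-≤-trans; <⇒≤; >⇒≢; 1+n≢n; m<n⇒m<1+n; m≤m+n;
         *-mono-≤; *-cancelˡ-≤; m≤n⇒∃[o]m+o≡n; +-commutativeSemigroup)
open import Data.Nat.ListAction using (sum)
open import Data.Nat.ListAction.Properties using (sum-↭)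
open import Data.Nat.Tactic.RingSolver using (solve-∀)
open import Data.List using (List; []; _∷_; _∷ʳ_; length; deduplicate)
open import Data.List.Properties using (filter-all; ∷-injectiveˡ)
open import Data.List.Relation.Unary.All as All using (All; []; _∷_)
open import Data.List.Relation.Unary.AllPairs as AllPairs using (AllPairs; []; _∷_)
import Data.List.Relation.Unary.AllPairs.Properties as AllPairs
open import Data.List.Relation.Unary.All.Properties using (∷ʳ⁺)
import Data.List.Relation.Unary.Linked as Linked
open import Data.List.Relation.Unary.Linked.Properties using (AllPairs⇒Linked)
open import Data.List.Relation.Unary.Unique.Propositional using (Unique)
open import Data.List.Relation.Binary.Permutation.Propositional using (_↭_; ↭-refl; ↭-sym)
open import Data.List.Relation.Binary.Permutation.Propositional.Properties
  using (∷↭∷ʳ; ↭-length)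
open import Algebra.Properties.CommutativeSemigroup +-commutativeSemigroup using (xy∙z≈xz∙y)
open import Data.Product using (∃; ∃₂; _×_; _,_)
open import Data.Sum using (inj₁)
open import Function using (_∘_)
open import Relation.Nullary using (¬?)
open import Relation.Binary.PropositionalEquality
  using (_≡_; refl; sym; trans; cong; subst; subst₂; module ≡-Reasoning)

StrictlyDecreasing : List ℕ → Set
StrictlyDecreasing = AllPairs _>_

SigmaStepEdge : ℕ → ℕ → Set
SigmaStepEdge n r = ∃₂ λ lam mu →
  IsPartition n lam × IsPartition n mu × σ lam ≡ r × σ mu ≡ suc r × Adjacent lam mu

deduplicate-unique : ∀ {xs} → Unique xs → deduplicate _≟_ xs ≡ xs
deduplicate-unique [] = refl
deduplicate-unique {x ∷ _} (x∉xs ∷ xs!) rewrite deduplicate-unique xs! =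
  cong (x ∷_) (filter-all (¬? ∘ (x ≟_)) x∉xs)

σ-strictlyDecreasing : ∀ {xs} → StrictlyDecreasing xs → σ xs ≡ length xs
σ-strictlyDecreasing xs↓ = cong length (deduplicate-unique (AllPairs.map >⇒≢ xs↓))

strictlyDecreasing-isPartition : ∀ {xs} → StrictlyDecreasing xs → All (1 ≤_) xs →
  IsPartition (sum xs) xs
strictlyDecreasing-isPartition xs↓ positive =
  Linked.map <⇒≤ (AllPairs⇒Linked xs↓) , positive , refl

raiseHead-strictlyDecreasing : ∀ {h ts} → StrictlyDecreasing (h ∷ ts) →
  StrictlyDecreasing (suc h ∷ ts)
raiseHead-strictlyDecreasing (h>ts ∷ ts↓) = All.map m<n⇒m<1+n h>ts ∷ ts↓

∷ʳ1-strictlyDecreasing : ∀ {xs} → StrictlyDecreasing xs → All (1 <_) xs →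
  StrictlyDecreasing (xs ∷ʳ 1)
∷ʳ1-strictlyDecreasing xs↓ xs>1 = AllPairs.++⁺ xs↓ ([] ∷ []) (All.map (_∷ []) xs>1)

splitOff-↭ : ∀ h ts → h ∷ ts ∷ʳ 1 ↭ 1 ∷ h ∷ ts
splitOff-↭ h ts = ↭-sym (∷↭∷ʳ 1 (h ∷ ts))

splitOff-adjacent : ∀ b ts → Adjacent (suc (suc b) ∷ ts) (suc b ∷ ts ∷ʳ 1)
splitOff-adjacent b ts =
  1+n≢n ∘ ∷-injectiveˡ , inj₁ (suc b , ts , ↭-refl , splitOff-↭ (suc b) ts)

splitOff-sigmaStepEdge : ∀ {h ts} → StrictlyDecreasing (h ∷ ts) → All (1 <_) (h ∷ ts) →
  SigmaStepEdge (sum (suc h ∷ ts)) (suc (length ts))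
splitOff-sigmaStepEdge {suc b} {ts} h∷ts↓ h∷ts>1@(s≤s (s≤s z≤n) ∷ _) =
  suc (suc b) ∷ ts , suc b ∷ ts ∷ʳ 1 ,
  strictlyDecreasing-isPartition lam↓ (s≤s z≤n ∷ All.map <⇒≤ (All.tail h∷ts>1)) ,
  subst₂ IsPartition (sum-↭ perm) refl
    (strictlyDecreasing-isPartition mu↓ (∷ʳ⁺ (All.map <⇒≤ h∷ts>1) ≤-refl)) ,
  σ-strictlyDecreasing lam↓ ,
  trans (σ-strictlyDecreasing mu↓) (↭-length perm) ,
  splitOff-adjacent b ts
  where
  lam↓ : StrictlyDecreasing (suc (suc b) ∷ ts)
  lam↓ = raiseHead-strictlyDecreasing h∷ts↓
  mu↓ : StrictlyDecreasing (suc b ∷ ts ∷ʳ 1)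
  mu↓ = ∷ʳ1-strictlyDecreasing h∷ts↓ h∷ts>1
  -- 1 ∷ suc b ∷ ts has the sum of λ and one more part, so it carries μ's size and σ.
  perm : suc b ∷ ts ∷ʳ 1 ↭ 1 ∷ suc b ∷ ts
  perm = splitOff-↭ (suc b) ts

stairs : ℕ → List ℕ
stairs zero = []
stairs (suc p) = suc (suc p) ∷ stairs p

length-stairs : ∀ p → length (stairs p) ≡ p
length-stairs zero = refl
length-stairs (suc p) = cong suc (length-stairs p)

stairs-< : ∀ p → All (_< suc (suc p)) (stairs p)
stairs-< zero = []
stairs-< (suc p) = ≤-refl ∷ All.map m<n⇒m<1+n (stairs-< p)

stairs->1 : ∀ p → All (1 <_) (stairs p)
stairs->1 zero = []
stairs->1 (suc p) = s≤s (s≤s z≤n) ∷ stairs->1 p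

stairs-strictlyDecreasing : ∀ p → StrictlyDecreasing (stairs p)
stairs-strictlyDecreasing zero = []
stairs-strictlyDecreasing (suc p) = stairs-< p ∷ stairs-strictlyDecreasing p

sum-stairs : ∀ p → 2 * suc (sum (stairs p)) ≡ suc p * suc (suc p)
sum-stairs zero = refl
sum-stairs (suc p) = begin
  2 * suc (suc (suc p) + s)              ≡⟨ distrib p s ⟩
  2 * suc (suc p) + 2 * suc s            ≡⟨ cong (2 * suc (suc p) +_) (sum-stairs p) ⟩
  2 * suc (suc p) + suc p * suc (suc p)  ≡⟨ factor p ⟩
  suc (suc p) * suc (suc (suc p))        ∎
  where
  open ≡-Reasoning
  s = sum (stairs p)
  distrib : ∀ p s → 2 * suc (suc (suc p) + s) ≡ 2 * suc (suc p) + 2 * suc s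
  distrib = solve-∀
  factor : ∀ p → 2 * suc (suc p) + suc p * suc (suc p) ≡ suc (suc p) * suc (suc (suc p))
  factor = solve-∀

stairs-fit : ∀ p n → suc (suc p) * suc (suc (suc p)) ≤ 2 * n →
  ∃ λ h → suc p < h × sum (suc h ∷ stairs p) ≡ n
stairs-fit p n fits =
  let j , room+j≡n = m≤n⇒∃[o]m+o≡n room
  in suc (suc (p + j)) , s≤s (s≤s (m≤m+n p j)) ,
     trans (cong (3 +_) (xy∙z≈xz∙y p j (sum (stairs p)))) room+j≡n
  where
  room : suc (sum (stairs (suc p))) ≤ n
  room = *-cancelˡ-≤ 2 (subst (_≤ 2 * n) (sym (sum-stairs (suc p))) fits)

toppedStairs-strictlyDecreasing : ∀ {p h} → suc p < h → StrictlyDecreasing (h ∷ stairs p)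
toppedStairs-strictlyDecreasing {p} p+1<h =
  All.map (λ t<p+2 → <-≤-trans t<p+2 p+1<h) (stairs-< p) ∷ stairs-strictlyDecreasing p

toppedStairs->1 : ∀ {p h} → suc p < h → All (1 <_) (h ∷ stairs p)
toppedStairs->1 {p} p+1<h = ≤-trans (s≤s (s≤s z≤n)) p+1<h ∷ stairs->1 p

proposition6p5 : (n k r : ℕ) → 1 ≤ n → IsRho n k → 1 ≤ r → r < k →
    ∃₂ λ (lam mu : List ℕ) →
      IsPartition n lam × IsPartition n mu ×
      σ lam ≡ r × σ mu ≡ suc r × Adjacent lam mu
proposition6p5 n k (suc p) _ (k[k+1]≤2n , _) _ r<k =
  let h , p+1<h , size≡n = stairs-fit p n (≤-trans (*-mono-≤ r<k (s≤s r<k)) k[k+1]≤2n)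
  in subst₂ SigmaStepEdge size≡n (cong suc (length-stairs p))
       (splitOff-sigmaStepEdge (toppedStairs-strictlyDecreasing p+1<h) (toppedStairs->1 p+1<h))
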